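{- For every formula $\varphi$ of $\mathsf{QRC_1}$, the sequent $\varphi\vdash\Diamond\varphi$ is not derivable in $\mathsf{QRC_1}$.
   Context: Fix a countable set of variables. A signature $\Sigma$ is a set of constants and a set of relation symbols with arities (no function symbols). A term is a variable or a constant. Formulas are built from $\top$ and $S(t_0,\dots,t_{n-1})$ ($S$ $n$-ary, $t_i$ terms) by $\wedge$, the unary modality $\Diamond$, and $\forall x$. $\mathrm{fv}(\varphi)$ is the set of free variables; $\varphi[x\leftarrow t]$ is simultaneous replacement of free occurrences of $x$ by $t$; $t$ is free for $x$ in $\varphi$ if no variable of $t$ becomes bound in $\varphi[x\leftarrow t]$. $\mathsf{QRC_1}$ derives sequents $\varphi\vdash\psi$ by: (i) $\varphi\vdash\top$, $\varphi\vdash\varphi$; (ii) $\varphi\wedge\psi\vdash\varphi$, $\varphi\wedge\psi\vdash\psi$; (iii) from $\varphi\vdash\psi$, $\varphi\vdash\chi$ infer $\varphi\vdash\psi\wedge\chi$; (iv) from $\varphi\vdash\psi$, $\psi\vdash\chi$ infer $\varphi\vdash\chi$; (v) from $\varphi\vdash\psi$ infer $\Diamond\varphi\vdash\Diamond\psi$; (vi) $\Diamond\Diamond\varphi\vdash\Diamond\varphi$; (vii) $\Diamond\forall x\varphi\vdash\forall x\Diamond\varphi$; (viii) from $\varphi\vdash\psi$ infer $\varphi\vdash\forall x\psi$ if $x\notin\mathrm{fv}(\varphi)$; (ix) from $\varphi[x\leftarrow t]\vdash\psi$ infer $\forall x\varphi\vdash\psi$ if $t$ is free for $x$ in $\varphi$;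 (x) from $\varphi\vdash\psi$ infer $\varphi[x\leftarrow t]\vdash\psi[x\leftarrow t]$ if $t$ is free for $x$ in $\varphi$ and $\psi$; (xi) from $\varphi[x\leftarrow c]\vdash\psi[x\leftarrow c]$ infer $\varphi\vdash\psi$ if the constant $c$ occurs in neither $\varphi$ nor $\psi$. -}

module Defs where

open import Data.Nat using (ℕ; _≟_)
open import Data.Vec using (Vec; map)
open import Data.Vec.Membership.Propositional using (_∈_)
open import Relation.Binary.PropositionalEquality using (_≡_; _≢_)
open import Relation.Nullary using (¬_; yes; no)

record Signature : Set₁ where
  field
    Const : Set
    Rel   : Set
    arity : Rel → ℕ

Var : Set
Var = ℕ

module Syntax (Σ : Signature) where
  open Signature Σ

  data Term : Set where
    var   : Var → Term
    const : Const → Term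

  infixr 6 _∧_
  data Formula : Set where
    ⊤'   : Formula
    rel  : (S : Rel) → Vec Term (arity S) → Formula
    _∧_  : Formula → Formula → Formula
    ◇    : Formula → Formula
    ∀'   : Var → Formula → Formula

  data _∈fv_ (x : Var) : Formula → Set where
    fv-rel : ∀ {S ts} → var x ∈ ts → x ∈fv rel S ts
    fv-∧ˡ  : ∀ {φ ψ} → x ∈fv φ → x ∈fv (φ ∧ ψ)
    fv-∧ʳ  : ∀ {φ ψ} → x ∈fv ψ → x ∈fv (φ ∧ ψ)
    fv-◇   : ∀ {φ} → x ∈fv φ → x ∈fv ◇ φ
    fv-∀   : ∀ {y φ} → x ≢ y → x ∈fv φ → x ∈fv ∀' y φ

  data _occursIn_ (c : Const) : Formula → Set where
    oc-rel : ∀ {S ts} → const c ∈ ts → c occursIn rel S ts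
    oc-∧ˡ  : ∀ {φ ψ} → c occursIn φ → c occursIn (φ ∧ ψ)
    oc-∧ʳ  : ∀ {φ ψ} → c occursIn ψ → c occursIn (φ ∧ ψ)
    oc-◇   : ∀ {φ} → c occursIn φ → c occursIn ◇ φ
    oc-∀   : ∀ {y φ} → c occursIn φ → c occursIn ∀' y φ

  substT : Term → Var → Term → Term
  substT (var y) x t with x ≟ y
  ... | yes _ = t
  ... | no  _ = var y
  substT (const c) x t = const c

  _[_←_] : Formula → Var → Term → Formula
  ⊤' [ x ← t ] = ⊤'
  rel S ts [ x ← t ] = rel S (map (λ s → substT s x t) ts)
  (φ ∧ ψ) [ x ← t ] = (φ [ x ← t ]) ∧ (ψ [ x ← t ])
  ◇ φ [ x ← t ] = ◇ (φ [ x ← t ])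
  ∀' y φ [ x ← t ] with x ≟ y
  ... | yes _ = ∀' y φ
  ... | no  _ = ∀' y (φ [ x ← t ])

  data FreeFor (t : Term) (x : Var) : Formula → Set where
    ff-⊤    : FreeFor t x ⊤'
    ff-rel  : ∀ {S ts} → FreeFor t x (rel S ts)
    ff-∧    : ∀ {φ ψ} → FreeFor t x φ → FreeFor t x ψ → FreeFor t x (φ ∧ ψ)
    ff-◇    : ∀ {φ} → FreeFor t x φ → FreeFor t x (◇ φ)
    -- no free occurrence of x below the binder: nothing is replaced
    ff-∀-no : ∀ {y φ} → ¬ (x ∈fv ∀' y φ) → FreeFor t x (∀' y φ)
    ff-∀    : ∀ {y φ} → t ≢ var y → FreeFor t x φ → FreeFor t x (∀' y φ)

  infix 4 _⊢_
  data _⊢_ : Formula → Formula → Set where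
    ax-⊤     : ∀ {φ} → φ ⊢ ⊤'
    ax-id    : ∀ {φ} → φ ⊢ φ
    ∧-elimˡ  : ∀ {φ ψ} → φ ∧ ψ ⊢ φ
    ∧-elimʳ  : ∀ {φ ψ} → φ ∧ ψ ⊢ ψ
    ∧-intro  : ∀ {φ ψ χ} → φ ⊢ ψ → φ ⊢ χ → φ ⊢ ψ ∧ χ
    cut      : ∀ {φ ψ χ} → φ ⊢ ψ → ψ ⊢ χ → φ ⊢ χ
    nec      : ∀ {φ ψ} → φ ⊢ ψ → ◇ φ ⊢ ◇ ψ
    trans4   : ∀ {φ} → ◇ (◇ φ) ⊢ ◇ φ
    ◇∀       : ∀ {x φ} → ◇ (∀' x φ) ⊢ ∀' x (◇ φ)
    ∀-intro  : ∀ {x φ ψ} → ¬ (x ∈fv φ) → φ ⊢ ψ → φ ⊢ ∀' x ψ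
    ∀-elim   : ∀ {x t φ ψ} → FreeFor t x φ → φ [ x ← t ] ⊢ ψ → ∀' x φ ⊢ ψ
    subst    : ∀ {x t φ ψ} → FreeFor t x φ → FreeFor t x ψ →
               φ ⊢ ψ → φ [ x ← t ] ⊢ ψ [ x ← t ]
    const-gen : ∀ {x c φ ψ} → ¬ (c occursIn φ) → ¬ (c occursIn ψ) →
               φ [ x ← const c ] ⊢ ψ [ x ← const c ] → φ ⊢ ψ

-- The modal depth of a formula (nesting depth of ◇) can only decrease along a
-- derivation: every rule is depth-antitone, and substitution does not change
-- the depth.  Since ◇ φ is one deeper than φ, φ ⊢ ◇ φ is never derivable.
module Submission where

open import Defs
open import Relation.Nullary using (¬_; yes; no)
open import Data.Nat using (ℕ; suc; _⊔_; _≤_; _≟_; z≤n; s≤s)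
open import Data.Nat.Properties using (≤-refl; ≤-trans; m≤m⊔n; m≤n⊔m; ⊔-lub; n≤1+n; 1+n≰n)
open import Relation.Binary.PropositionalEquality using (_≡_; refl; cong; cong₂; subst; subst₂; sym)

module ModalDepth (Σ : Signature) where
  open Syntax Σ hiding (subst)

  depth : Formula → ℕ
  depth ⊤'         = 0
  depth (rel S ts) = 0
  depth (φ ∧ ψ)    = depth φ ⊔ depth ψ
  depth (◇ φ)      = suc (depth φ)
  depth (∀' x φ)   = depth φ

  depth-[←] : ∀ φ x t → depth (φ [ x ← t ]) ≡ depth φ
  depth-[←] ⊤'         x t = refl
  depth-[←] (rel S ts) x t = refl
  depth-[←] (φ ∧ ψ)    x t = cong₂ _⊔_ (depth-[←] φ x t) (depth-[←] ψ x t)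
  depth-[←] (◇ φ)      x t = cong suc (depth-[←] φ x t)
  depth-[←] (∀' y φ)   x t with x ≟ y
  ... | yes _ = refl
  ... | no  _ = depth-[←] φ x t

  ⊢-depth-antitone : ∀ {φ ψ} → φ ⊢ ψ → depth ψ ≤ depth φ
  ⊢-depth-antitone ax-⊤                  = z≤n
  ⊢-depth-antitone ax-id                 = ≤-refl
  ⊢-depth-antitone (∧-elimˡ {φ} {ψ})     = m≤m⊔n (depth φ) (depth ψ)
  ⊢-depth-antitone (∧-elimʳ {φ} {ψ})     = m≤n⊔m (depth φ) (depth ψ)
  ⊢-depth-antitone (∧-intro p q)         = ⊔-lub (⊢-depth-antitone p) (⊢-depth-antitone q)
  ⊢-depth-antitone (cut p q)             = ≤-trans (⊢-depth-antitone q) (⊢-depth-antitone p)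
  ⊢-depth-antitone (nec p)               = s≤s (⊢-depth-antitone p)
  ⊢-depth-antitone trans4                = n≤1+n _
  ⊢-depth-antitone ◇∀                    = ≤-refl
  ⊢-depth-antitone (∀-intro _ p)         = ⊢-depth-antitone p
  ⊢-depth-antitone (∀-elim {x} {t} {φ} {ψ} _ p) =
    subst (depth ψ ≤_) (depth-[←] φ x t) (⊢-depth-antitone p)
  ⊢-depth-antitone (Syntax.subst {x} {t} {φ} {ψ} _ _ p) =
    subst₂ _≤_ (sym (depth-[←] ψ x t)) (sym (depth-[←] φ x t)) (⊢-depth-antitone p)
  ⊢-depth-antitone (const-gen {x} {c} {φ} {ψ} _ _ p) =
    subst₂ _≤_ (depth-[←] ψ x (const c)) (depth-[←] φ x (const c)) (⊢-depth-antitone p)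

corollary2p5 : (Σ : Signature) → let open Syntax Σ in
    (φ : Formula) → ¬ (φ ⊢ ◇ φ)
corollary2p5 Σ φ φ⊢◇φ = 1+n≰n (ModalDepth.⊢-depth-antitone Σ φ⊢◇φ)
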